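{- For every $n\ge 5$, the cycle graph $C_n$ on $n$ vertices belongs to $\mathcal{G}_2$; that is, there exist $2$-uniform words $w,v$ over the vertex set of $C_n$, each containing every vertex, such that $C_n=G(w,v)$.
   Context: For a word $w$, $\mathrm{alph}(w)$ is the set of letters occurring in $w$ and $|w|_a$ the number of occurrences of $a$; $w$ is $k$-uniform if $|w|_a=k$ for all $a\in\mathrm{alph}(w)$. For letters $a,b$, $\pi_{a,b}$ is the monoid morphism on words with $a\mapsto a$, $b\mapsto b$ and all other letters mapped to the empty word. For words $w,v$ with $\mathrm{alph}(w)=\mathrm{alph}(v)=A$, $G(w,v)$ is the undirected simple graph on vertex set $A$ in which distinct $a,b$ are adjacent iff $\pi_{a,b}(w)=\pi_{a,b}(v)$. For $k\in\mathbb{N}$, $\mathcal{G}_k$ is the set of graphs $G$ for which there exist $k$-uniform words $w,v\in V(G)^\ast$ with $G=G(w,v)$. -}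

module Defs where

open import Data.Nat using (ℕ; suc; _+_)
open import Data.Fin using (Fin; toℕ; _≟_)
open import Data.List using (List; filter)
open import Data.List.Membership.Propositional using (_∈_)
open import Data.Sum using (_⊎_)
open import Data.Product using (_×_; ∃-syntax)
open import Relation.Nullary using (¬_)
open import Relation.Binary.PropositionalEquality using (_≡_)
open import Function.Bundles using (_⇔_)
import Data.List.Relation.Unary.Any as Any
open import Data.List using (length)

Word : ℕ → Set
Word n = List (Fin n)

count : ∀ {n} → Fin n → Word n → ℕ
count a w = length (filter (_≟ a) w)

FullAlph : ∀ {n} → Word n → Set
FullAlph {n} w = (a : Fin n) → a ∈ w

Uniform : ∀ {n} → ℕ → Word n → Set
Uniform k w = ∀ a → a ∈ w → count a w ≡ k

proj : ∀ {n} → Fin n → Fin n → Word n → Word n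
proj a b w = filter (λ x → Relation.Nullary.Decidable.Core._⊎-dec_ (x ≟ a) (x ≟ b)) w
  where import Relation.Nullary.Decidable.Core

GAdj : ∀ {n} → Word n → Word n → Fin n → Fin n → Set
GAdj w v a b = (¬ a ≡ b) × (proj a b w ≡ proj a b v)

InG : ℕ → (n : ℕ) → (Fin n → Fin n → Set) → Set
InG k n Adj = ∃[ w ] ∃[ v ]
  (FullAlph w × FullAlph v × Uniform k w × Uniform k v ×
   (∀ a b → Adj a b ⇔ GAdj w v a b))

CycleAdj : (n : ℕ) → Fin n → Fin n → Set
CycleAdj n i j = (toℕ j ≡ toℕ i + 1) ⊎ (toℕ i ≡ toℕ j + 1)
               ⊎ (toℕ i ≡ 0 × suc (toℕ j) ≡ n) ⊎ (toℕ j ≡ 0 × suc (toℕ i) ≡ n)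

{-# OPTIONS --safe #-}
module Submission where

-- With letters 0, …, M (so n = M + 1) take the 2-uniform words
--   w = 0 1 0 2 1 3 2 ⋯ M (M−1) M      and      v = 0 1 ⋯ (M−1) 0 M 1 2 ⋯ M.
-- For letters a < b, π_{a,b}(w) is abab when b = a + 1 and aabb otherwise, while
-- π_{a,b}(v) is aabb for {a, b} = {0, M} and abab otherwise. As M ≥ 2, the letters 0 and M
-- are not consecutive, so the projections agree exactly on consecutive letters and on
-- {0, M}: the edges of the cycle. The argument works for every n ≥ 3.

open import Defs
open import Data.Nat.Base using (ℕ; zero; suc; _+_; _≤_; _<_; s≤s; z≤n; s≤s⁻¹)
open import Data.Nat.Properties as ℕ
  using ( ≤-refl; ≤-trans; ≤-<-trans; <-≤-trans; <⇒≢; >⇒≢; 1+n≢n; n≤1+n; m≤n⇒m≤1+n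
        ; m≤n⇒m<n∨m≡n; +-suc; +-comm)
open import Data.Fin.Base as Fin using (Fin; toℕ; fromℕ<)
import Data.Fin.Properties as Fin
open import Data.List.Base using (List; []; _∷_; _++_; filter; map; length; iterate)
open import Data.List.Properties
  using ( filter-accept; filter-reject; filter-++; filter-none; filter-≐; map-injective
        ; length-map; ++-assoc; ++-identityʳ; ∷-injective)
open import Data.List.Relation.Unary.All as All using (All; []; _∷_)
open import Data.List.Relation.Unary.All.Properties using (++⁺)
open import Data.List.Relation.Unary.Any using (here)
open import Data.List.Membership.Propositional using (_∈_)
open import Data.List.Membership.Propositional.Properties using (∈-filter⁻)
open import Data.Product using (Σ; _×_; _,_; proj₁; proj₂)
import Data.Sum as Sum
open import Data.Sum using (_⊎_; inj₁; inj₂)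
open import Data.Bool.Base using (true; false)
open import Function.Base using (_∘_)
open import Function.Bundles using (_⇔_; mk⇔; Equivalence)
open import Function.Construct.Composition using (_⇔-∘_)
open import Function.Construct.Symmetry using (⇔-sym)
open import Level using (0ℓ)
open import Relation.Nullary using (¬_; yes; no; does; contradiction)
open import Relation.Nullary.Decidable.Core using (_⊎-dec_; _×-dec_)
open import Relation.Unary using (Pred; Decidable)
open import Relation.Binary.Core using (Rel)
open import Relation.Binary.Definitions using (Symmetric; Irreflexive; tri<; tri≈; tri>)
open import Relation.Binary.PropositionalEquality
  using (_≡_; _≢_; refl; sym; trans; cong; cong₂; subst; module ≡-Reasoning)

open ≡-Reasoning

filter-map : ∀ {A B : Set} {P : Pred B 0ℓ} (P? : Decidable P) (f : A → B) xs →
             filter P? (map f xs) ≡ map f (filter (P? ∘ f) xs)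
filter-map P? f [] = refl
filter-map P? f (x ∷ xs) with does (P? (f x))
... | true  = cong (f x ∷_) (filter-map P? f xs)
... | false = filter-map P? f xs

symmetric-⇔-from-< : ∀ {n} {R S : Rel (Fin n) 0ℓ} →
  Symmetric R → Symmetric S → Irreflexive _≡_ R → Irreflexive _≡_ S →
  (∀ {a b} → a Fin.< b → R a b ⇔ S a b) → ∀ a b → R a b ⇔ S a b
symmetric-⇔-from-< symR symS irrR irrS agree a b with Fin.<-cmp a b
... | tri< a<b _ _ = agree a<b
... | tri≈ _ a≡b _ = mk⇔ (λ r → contradiction r (irrR a≡b)) (λ s → contradiction s (irrS a≡b))
... | tri> _ _ b<a = mk⇔ (symS ∘ Equivalence.to   (agree b<a) ∘ symR)
                         (symR ∘ Equivalence.from (agree b<a) ∘ symS)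

pair? : ∀ a b → Decidable (λ x → x ≡ a ⊎ x ≡ b)
pair? a b x = (x ℕ.≟ a) ⊎-dec (x ℕ.≟ b)

-- Opaque so that the lemmas below, rather than the unfolding of ℕ._≟_ at variables,
-- drive every computation of a projection; this keeps their implicit arguments inferable.
opaque
  projℕ : ℕ → ℕ → List ℕ → List ℕ
  projℕ a b = filter (pair? a b)

  occ : ℕ → List ℕ → List ℕ
  occ x = filter (ℕ._≟ x)

  occ-[] : ∀ {x} → occ x [] ≡ []
  occ-[] = refl

  occ-++ : ∀ {x} xs ys → occ x (xs ++ ys) ≡ occ x xs ++ occ x ys
  occ-++ {x} = filter-++ (ℕ._≟ x)

  occ-here : ∀ {x} xs → occ x (x ∷ xs) ≡ x ∷ occ x xs
  occ-here {x} xs = filter-accept (ℕ._≟ x) refl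

  occ-there : ∀ {x y} xs → y ≢ x → occ x (y ∷ xs) ≡ occ x xs
  occ-there {x} xs = filter-reject (ℕ._≟ x)

  occ-none : ∀ {x xs} → All (_≢ x) xs → occ x xs ≡ []
  occ-none {x} = filter-none (ℕ._≟ x)

  projℕ-[] : ∀ {a b} → projℕ a b [] ≡ []
  projℕ-[] = refl

  projℕ-++ : ∀ {a b} xs ys → projℕ a b (xs ++ ys) ≡ projℕ a b xs ++ projℕ a b ys
  projℕ-++ {a} {b} = filter-++ (pair? a b)

  projℕ-keepˡ : ∀ {a b} xs → projℕ a b (a ∷ xs) ≡ a ∷ projℕ a b xs
  projℕ-keepˡ {a} {b} xs = filter-accept (pair? a b) (inj₁ refl)

  projℕ-keepʳ : ∀ {a b} xs → projℕ a b (b ∷ xs) ≡ b ∷ projℕ a b xs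
  projℕ-keepʳ {a} {b} xs = filter-accept (pair? a b) (inj₂ refl)

  projℕ-drop : ∀ {a b x} xs → x ≢ a → x ≢ b → projℕ a b (x ∷ xs) ≡ projℕ a b xs
  projℕ-drop {a} {b} xs x≢a x≢b = filter-reject (pair? a b) Sum.[ x≢a , x≢b ]

  projℕ-above : ∀ {a b xs} → a < b → All (b <_) xs → projℕ a b xs ≡ []
  projℕ-above {a} {b} a<b =
    filter-none (pair? a b) ∘ All.map (λ b<x → Sum.[ >⇒≢ (ℕ.<-trans a<b b<x) , >⇒≢ b<x ])

  projℕ≡occ : ∀ {a b xs} → All (_≢ b) xs → projℕ a b xs ≡ occ a xs
  projℕ≡occ [] = refl
  projℕ≡occ {a} {b} {x ∷ xs} (x≢b ∷ xs≢b) with x ℕ.≟ a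
  ... | yes refl =
    trans (projℕ-keepˡ xs) (trans (cong (a ∷_) (projℕ≡occ xs≢b)) (sym (occ-here xs)))
  ... | no x≢a   =
    trans (projℕ-drop xs x≢a x≢b) (trans (projℕ≡occ xs≢b) (sym (occ-there xs x≢a)))

  projℕ-comm : ∀ {a b} xs → projℕ a b xs ≡ projℕ b a xs
  projℕ-comm {a} {b} = filter-≐ (pair? a b) (pair? b a) (Sum.swap , Sum.swap)

GAdjℕ : List ℕ → List ℕ → ℕ → ℕ → Set
GAdjℕ xs ys a b = a ≢ b × projℕ a b xs ≡ projℕ a b ys

GAdjℕ-irrefl : ∀ {xs ys} → Irreflexive _≡_ (GAdjℕ xs ys)
GAdjℕ-irrefl a≡b (a≢b , _) = a≢b a≡b

GAdjℕ-sym : ∀ {xs ys} → Symmetric (GAdjℕ xs ys)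
GAdjℕ-sym {xs} {ys} {a} {b} (a≢b , eq) =
  a≢b ∘ sym , trans (sym (projℕ-comm xs)) (trans eq (projℕ-comm ys))

alternating grouped : ℕ → ℕ → List ℕ
alternating a b = a ∷ b ∷ a ∷ b ∷ []
grouped     a b = a ∷ a ∷ b ∷ b ∷ []

grouped≢alternating : ∀ {a b} → a ≢ b → grouped a b ≢ alternating a b
grouped≢alternating a≢b eq = a≢b (proj₁ (∷-injective (proj₂ (∷-injective eq))))

stairs : ℕ → List ℕ
stairs zero    = 0 ∷ []
stairs (suc k) = stairs k ++ suc k ∷ k ∷ []

stairs-≤ : ∀ k → All (_≤ k) (stairs k)
stairs-≤ zero    = z≤n ∷ []
stairs-≤ (suc k) = ++⁺ (All.map m≤n⇒m≤1+n (stairs-≤ k)) (≤-refl ∷ n≤1+n k ∷ [])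

stairs-≢ : ∀ {k x} → k < x → All (_≢ x) (stairs k)
stairs-≢ k<x = All.map (λ y≤k → <⇒≢ (≤-<-trans y≤k k<x)) (stairs-≤ _)

occ-stairs-top : ∀ k → occ k (stairs k) ≡ k ∷ []
occ-stairs-top zero    = trans (occ-here []) (cong (0 ∷_) occ-[])
occ-stairs-top (suc k) = begin
  occ (suc k) (stairs k ++ suc k ∷ k ∷ [])
    ≡⟨ occ-++ (stairs k) _ ⟩
  occ (suc k) (stairs k) ++ occ (suc k) (suc k ∷ k ∷ [])
    ≡⟨ cong₂ _++_ (occ-none (stairs-≢ ≤-refl)) (occ-here _) ⟩
  suc k ∷ occ (suc k) (k ∷ [])
    ≡⟨ cong (suc k ∷_) (trans (occ-there [] (<⇒≢ ≤-refl)) occ-[]) ⟩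
  suc k ∷ []
    ∎

occ-stairs-below : ∀ {x k} → x < k → occ x (stairs k) ≡ x ∷ x ∷ []
occ-stairs-below {x} {suc k} x<1+k =
  trans (occ-++ (stairs k) _) (split (m≤n⇒m<n∨m≡n (s≤s⁻¹ x<1+k)))
  where
  split : x < k ⊎ x ≡ k → occ x (stairs k) ++ occ x (suc k ∷ k ∷ []) ≡ x ∷ x ∷ []
  split (inj₁ x<k)  = cong₂ _++_ (occ-stairs-below x<k)
    (occ-none (>⇒≢ (ℕ.<-trans x<k ≤-refl) ∷ >⇒≢ x<k ∷ []))
  split (inj₂ refl) = cong₂ _++_ (occ-stairs-top x)
    (trans (occ-there _ 1+n≢n) (trans (occ-here []) (cong (x ∷_) occ-[])))

projℕ-stairs-stable : ∀ {a b k} → a < b → b < k →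
                      projℕ a b (stairs k) ≡ projℕ a b (stairs (suc b))
projℕ-stairs-stable {a} {b} {suc k} a<b b<1+k with m≤n⇒m<n∨m≡n (s≤s⁻¹ b<1+k)
... | inj₂ refl = refl
... | inj₁ b<k  = begin
  projℕ a b (stairs k ++ suc k ∷ k ∷ [])
    ≡⟨ projℕ-++ (stairs k) _ ⟩
  projℕ a b (stairs k) ++ projℕ a b (suc k ∷ k ∷ [])
    ≡⟨ cong (projℕ a b (stairs k) ++_) (projℕ-above a<b (ℕ.<-trans b<k ≤-refl ∷ b<k ∷ [])) ⟩
  projℕ a b (stairs k) ++ []
    ≡⟨ ++-identityʳ _ ⟩
  projℕ a b (stairs k)
    ≡⟨ projℕ-stairs-stable a<b b<k ⟩
  projℕ a b (stairs (suc b))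
    ∎

projℕ-stairs-top : ∀ {a c} → a < suc c →
  projℕ a (suc c) (stairs (suc (suc c))) ≡ occ a (stairs c) ++ suc c ∷ occ a (c ∷ []) ++ suc c ∷ []
projℕ-stairs-top {a} {c} a<b = begin
  projℕ a b ((stairs c ++ b ∷ c ∷ []) ++ suc b ∷ b ∷ [])
    ≡⟨ projℕ-++ (stairs c ++ b ∷ c ∷ []) _ ⟩
  projℕ a b (stairs c ++ b ∷ c ∷ []) ++ projℕ a b (suc b ∷ b ∷ [])
    ≡⟨ cong₂ _++_ (projℕ-++ (stairs c) _) last ⟩
  (projℕ a b (stairs c) ++ projℕ a b (b ∷ c ∷ [])) ++ b ∷ []
    ≡⟨ cong (λ u → (u ++ projℕ a b (b ∷ c ∷ [])) ++ b ∷ []) (projℕ≡occ (stairs-≢ ≤-refl)) ⟩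
  (occ a (stairs c) ++ projℕ a b (b ∷ c ∷ [])) ++ b ∷ []
    ≡⟨ cong (λ u → (occ a (stairs c) ++ u) ++ b ∷ []) middle ⟩
  (occ a (stairs c) ++ b ∷ occ a (c ∷ [])) ++ b ∷ []
    ≡⟨ ++-assoc (occ a (stairs c)) _ _ ⟩
  occ a (stairs c) ++ b ∷ occ a (c ∷ []) ++ b ∷ []
    ∎
  where
  b = suc c
  last : projℕ a b (suc b ∷ b ∷ []) ≡ b ∷ []
  last = trans (projℕ-drop _ (>⇒≢ (ℕ.<-trans a<b ≤-refl)) 1+n≢n)
               (trans (projℕ-keepʳ []) (cong (b ∷_) projℕ-[]))
  middle : projℕ a b (b ∷ c ∷ []) ≡ b ∷ occ a (c ∷ [])
  middle = trans (projℕ-keepʳ _) (cong (b ∷_) (projℕ≡occ (<⇒≢ ≤-refl ∷ [])))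

projℕ-stairs-consecutive : ∀ a → projℕ a (suc a) (stairs (suc (suc a))) ≡ alternating a (suc a)
projℕ-stairs-consecutive a = trans (projℕ-stairs-top ≤-refl)
  (cong₂ (λ u v → u ++ suc a ∷ v ++ suc a ∷ [])
         (occ-stairs-top a) (trans (occ-here []) (cong (a ∷_) occ-[])))

projℕ-stairs-distant : ∀ {a c} → a < c →
                       projℕ a (suc c) (stairs (suc (suc c))) ≡ grouped a (suc c)
projℕ-stairs-distant {a} {c} a<c = trans (projℕ-stairs-top (ℕ.<-trans a<c ≤-refl))
  (cong₂ (λ u v → u ++ suc c ∷ v ++ suc c ∷ [])
         (occ-stairs-below a<c) (occ-none (>⇒≢ a<c ∷ [])))

wordW : ℕ → List ℕ
wordW M = stairs M ++ M ∷ []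

wordW-< : ∀ M → All (_< suc M) (wordW M)
wordW-< M = ++⁺ (All.map s≤s (stairs-≤ M)) (≤-refl ∷ [])

projℕ-wordW : ∀ {a b M} → a < b → b ≤ M → projℕ a b (wordW M) ≡ projℕ a b (stairs (suc b))
projℕ-wordW {a} {b} {M} a<b b≤M = begin
  projℕ a b (stairs M ++ M ∷ [])
    ≡⟨ projℕ-++ (stairs M) _ ⟩
  projℕ a b (stairs M) ++ projℕ a b (M ∷ [])
    ≡⟨ cong (projℕ a b (stairs M) ++_) (sym (projℕ-drop _ 1+M≢a 1+M≢b)) ⟩
  projℕ a b (stairs M) ++ projℕ a b (suc M ∷ M ∷ [])
    ≡⟨ sym (projℕ-++ (stairs M) _) ⟩
  projℕ a b (stairs (suc M))
    ≡⟨ projℕ-stairs-stable a<b (s≤s b≤M) ⟩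
  projℕ a b (stairs (suc b))
    ∎
  where
  1+M≢b = >⇒≢ (s≤s b≤M)
  1+M≢a = >⇒≢ (ℕ.<-trans a<b (s≤s b≤M))

projℕ-wordW-consecutive : ∀ {a M} → suc a ≤ M →
                          projℕ a (suc a) (wordW M) ≡ alternating a (suc a)
projℕ-wordW-consecutive {a} 1+a≤M =
  trans (projℕ-wordW ≤-refl 1+a≤M) (projℕ-stairs-consecutive a)

projℕ-wordW-distant : ∀ {a b M} → suc a < b → b ≤ M → projℕ a b (wordW M) ≡ grouped a b
projℕ-wordW-distant {b = suc c} (s≤s a<c) b≤M =
  trans (projℕ-wordW (ℕ.<-trans a<c ≤-refl) b≤M) (projℕ-stairs-distant a<c)

occ-wordW : ∀ {x M} → x ≤ M → occ x (wordW M) ≡ x ∷ x ∷ []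
occ-wordW {x} {M} x≤M = trans (occ-++ (stairs M) _) (split (m≤n⇒m<n∨m≡n x≤M))
  where
  split : x < M ⊎ x ≡ M → occ x (stairs M) ++ occ x (M ∷ []) ≡ x ∷ x ∷ []
  split (inj₁ x<M)  = trans (cong₂ _++_ (occ-stairs-below x<M) (occ-none (>⇒≢ x<M ∷ [])))
                            (++-identityʳ _)
  split (inj₂ refl) = cong₂ _++_ (occ-stairs-top x) (trans (occ-here []) (cong (x ∷_) occ-[]))

iterate-≥ : ∀ s l → All (s ≤_) (iterate suc s l)
iterate-≥ s zero    = []
iterate-≥ s (suc l) = ≤-refl ∷ All.map ℕ.<⇒≤ (iterate-≥ (suc s) l)

iterate-< : ∀ s l → All (_< s + l) (iterate suc s l)
iterate-< s zero    = []
iterate-< s (suc l) =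
  ℕ.m<m+n s ℕ.0<1+n ∷ All.map (λ {y} → subst (y <_) (sym (+-suc s l))) (iterate-< (suc s) l)

occ-iterate : ∀ {x s l} → s ≤ x → x < s + l → occ x (iterate suc s l) ≡ x ∷ []
occ-iterate {x} {s} {zero} s≤x x<s+0 =
  contradiction s≤x (ℕ.<⇒≱ (subst (x <_) (ℕ.+-identityʳ s) x<s+0))
occ-iterate {x} {s} {suc l} s≤x x<s+1+l with m≤n⇒m<n∨m≡n s≤x
... | inj₂ refl = trans (occ-here _) (cong (x ∷_) (occ-none (All.map >⇒≢ (iterate-≥ (suc x) l))))
... | inj₁ s<x  = trans (occ-there _ (<⇒≢ s<x)) (occ-iterate s<x (subst (x <_) (+-suc s l) x<s+1+l))

occ-iterate-below : ∀ {x s l} → x < s → occ x (iterate suc s l) ≡ []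
occ-iterate-below {s = s} {l} x<s =
  occ-none (All.map (λ s≤y → >⇒≢ (<-≤-trans x<s s≤y)) (iterate-≥ s l))

occ-iterate-above : ∀ {x s l} → s + l ≤ x → occ x (iterate suc s l) ≡ []
occ-iterate-above {s = s} {l} s+l≤x =
  occ-none (All.map (λ y<s+l → <⇒≢ (<-≤-trans y<s+l s+l≤x)) (iterate-< s l))

projℕ-iterate : ∀ {a b} s l → a < b →
  projℕ a b (iterate suc s l) ≡ occ a (iterate suc s l) ++ occ b (iterate suc s l)
projℕ-iterate s zero a<b = trans projℕ-[] (sym (cong₂ _++_ occ-[] occ-[]))
projℕ-iterate {a} {b} s (suc l) a<b with s ℕ.≟ a | s ℕ.≟ b
... | yes refl | _ = begin
  projℕ a b (a ∷ rest)
    ≡⟨ projℕ-keepˡ rest ⟩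
  a ∷ projℕ a b rest
    ≡⟨ cong (a ∷_) (projℕ-iterate (suc s) l a<b) ⟩
  (a ∷ occ a rest) ++ occ b rest
    ≡⟨ sym (cong₂ _++_ (occ-here rest) (occ-there rest (<⇒≢ a<b))) ⟩
  occ a (a ∷ rest) ++ occ b (a ∷ rest)
    ∎
  where rest = iterate suc (suc s) l
... | no s≢a | yes refl = begin
  projℕ a b (b ∷ rest)
    ≡⟨ projℕ-keepʳ rest ⟩
  b ∷ projℕ a b rest
    ≡⟨ cong (b ∷_) (projℕ-iterate (suc s) l a<b) ⟩
  b ∷ (occ a rest ++ occ b rest)
    ≡⟨ cong (λ u → b ∷ (u ++ occ b rest)) a∉rest ⟩
  b ∷ occ b rest
    ≡⟨ sym (cong₂ _++_ (trans (occ-there rest s≢a) a∉rest) (occ-here rest)) ⟩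
  occ a (b ∷ rest) ++ occ b (b ∷ rest)
    ∎
  where
  rest = iterate suc (suc s) l
  a∉rest = occ-iterate-below (ℕ.<-trans a<b ≤-refl)
... | no s≢a | no s≢b = begin
  projℕ a b (s ∷ rest)
    ≡⟨ projℕ-drop rest s≢a s≢b ⟩
  projℕ a b rest
    ≡⟨ projℕ-iterate (suc s) l a<b ⟩
  occ a rest ++ occ b rest
    ≡⟨ sym (cong₂ _++_ (occ-there rest s≢a) (occ-there rest s≢b)) ⟩
  occ a (s ∷ rest) ++ occ b (s ∷ rest)
    ∎
  where rest = iterate suc (suc s) l

wordV : ℕ → List ℕ
wordV M = iterate suc 0 M ++ 0 ∷ M ∷ iterate suc 1 M

wordV-< : ∀ M → All (_< suc M) (wordV M)
wordV-< M = ++⁺ (All.map ℕ.m<n⇒m<1+n (iterate-< 0 M)) (ℕ.0<1+n ∷ ≤-refl ∷ iterate-< 1 M)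

module _ {a b M : ℕ} (a<b : a < b) where

  private
    R₀ R₁ : List ℕ
    R₀ = iterate suc 0 M
    R₁ = iterate suc 1 M

  projℕ-wordV : ∀ {p q r s t} →
    occ a R₀ ≡ p → occ b R₀ ≡ q → projℕ a b (0 ∷ M ∷ []) ≡ r → occ a R₁ ≡ s → occ b R₁ ≡ t →
    projℕ a b (wordV M) ≡ (p ++ q) ++ r ++ s ++ t
  projℕ-wordV refl refl refl refl refl = begin
    projℕ a b (R₀ ++ (0 ∷ M ∷ []) ++ R₁)
      ≡⟨ projℕ-++ R₀ _ ⟩
    projℕ a b R₀ ++ projℕ a b ((0 ∷ M ∷ []) ++ R₁)
      ≡⟨ cong (projℕ a b R₀ ++_) (projℕ-++ (0 ∷ M ∷ []) R₁) ⟩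
    projℕ a b R₀ ++ projℕ a b (0 ∷ M ∷ []) ++ projℕ a b R₁
      ≡⟨ cong₂ (λ u v → u ++ projℕ a b (0 ∷ M ∷ []) ++ v)
               (projℕ-iterate 0 M a<b) (projℕ-iterate 1 M a<b) ⟩
    (occ a R₀ ++ occ b R₀) ++ projℕ a b (0 ∷ M ∷ []) ++ occ a R₁ ++ occ b R₁
      ∎

projℕ-wordV-corner : ∀ {M} → 0 < M → projℕ 0 M (wordV M) ≡ grouped 0 M
projℕ-wordV-corner {M} 0<M = projℕ-wordV 0<M
  (occ-iterate z≤n 0<M) (occ-iterate-above ≤-refl)
  (trans (projℕ-keepˡ _) (cong (0 ∷_) (trans (projℕ-keepʳ []) (cong (M ∷_) projℕ-[]))))
  (occ-iterate-below ℕ.0<1+n) (occ-iterate 0<M ≤-refl)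

projℕ-wordV-alternating : ∀ {a b M} → a < b → b ≤ M → ¬ (a ≡ 0 × b ≡ M) →
                          projℕ a b (wordV M) ≡ alternating a b
projℕ-wordV-alternating {zero} {b} {M} 0<b b≤M ¬corner = projℕ-wordV 0<b
  (occ-iterate z≤n (<-≤-trans 0<b b≤M)) (occ-iterate z≤n b<M)
  (trans (projℕ-keepˡ _) (cong (0 ∷_) (trans (projℕ-drop [] M≢0 (>⇒≢ b<M)) projℕ-[])))
  (occ-iterate-below ℕ.0<1+n) (occ-iterate 0<b (s≤s b≤M))
  where
  b<M = ℕ.≤∧≢⇒< b≤M (λ b≡M → ¬corner (refl , b≡M))
  M≢0 = >⇒≢ (<-≤-trans 0<b b≤M)
projℕ-wordV-alternating {suc a} {b} {M} a<b b≤M _ with m≤n⇒m<n∨m≡n b≤M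
... | inj₂ refl = projℕ-wordV a<b
  (occ-iterate z≤n a<b) (occ-iterate-above ≤-refl)
  (trans (projℕ-drop _ (λ ()) (<⇒≢ 0<b)) (trans (projℕ-keepʳ []) (cong (b ∷_) projℕ-[])))
  (occ-iterate (s≤s z≤n) (ℕ.<-trans a<b ≤-refl)) (occ-iterate 0<b ≤-refl)
  where 0<b = <-≤-trans ℕ.0<1+n a<b
... | inj₁ b<M = projℕ-wordV a<b
  (occ-iterate z≤n (ℕ.<-trans a<b b<M)) (occ-iterate z≤n b<M)
  (trans (projℕ-drop _ (λ ()) (<⇒≢ 0<b))
         (trans (projℕ-drop [] (>⇒≢ (ℕ.<-trans a<b b<M)) (>⇒≢ b<M)) projℕ-[]))
  (occ-iterate (s≤s z≤n) (ℕ.<-trans a<b (s≤s b≤M))) (occ-iterate 0<b (s≤s b≤M))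
  where 0<b = <-≤-trans ℕ.0<1+n a<b

occ-wordV : ∀ {x M} → 0 < M → x ≤ M → occ x (wordV M) ≡ x ∷ x ∷ []
occ-wordV {zero} {M} 0<M _ = trans (occ-++ (iterate suc 0 M) _) (cong₂ _++_
  (occ-iterate z≤n 0<M)
  (trans (occ-here _) (cong (0 ∷_) (trans (occ-there _ (>⇒≢ 0<M)) (occ-iterate-below ℕ.0<1+n)))))
occ-wordV {suc x} {M} 0<M 1+x≤M =
  trans (occ-++ (iterate suc 0 M) _) (split (m≤n⇒m<n∨m≡n 1+x≤M))
  where
  split : suc x < M ⊎ suc x ≡ M →
          occ (suc x) (iterate suc 0 M) ++ occ (suc x) (0 ∷ M ∷ iterate suc 1 M) ≡ suc x ∷ suc x ∷ []
  split (inj₁ 1+x<M) = cong₂ _++_ (occ-iterate z≤n 1+x<M)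
    (trans (occ-there _ (λ ()))
           (trans (occ-there _ (>⇒≢ 1+x<M)) (occ-iterate (s≤s z≤n) (ℕ.<-trans 1+x<M ≤-refl))))
  split (inj₂ refl) = cong₂ _++_ (occ-iterate-above ≤-refl)
    (trans (occ-there _ (λ ())) (trans (occ-here _) (cong (suc x ∷_) (occ-iterate 0<M ≤-refl))))

CycleEdge : ℕ → ℕ → ℕ → Set
CycleEdge M a b = b ≡ suc a ⊎ (a ≡ 0 × b ≡ M)

GAdjℕ-words⇔CycleEdge : ∀ {a b M} → 2 ≤ M → a < b → b ≤ M →
                        GAdjℕ (wordW M) (wordV M) a b ⇔ CycleEdge M a b
GAdjℕ-words⇔CycleEdge {a} {b} {M} 2≤M a<b b≤M with m≤n⇒m<n∨m≡n a<b
... | inj₂ refl = mk⇔ (λ _ → inj₁ refl) λ _ →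
  <⇒≢ a<b , trans (projℕ-wordW-consecutive b≤M) (sym (projℕ-wordV-alternating a<b b≤M ¬corner))
  where
  ¬corner : ¬ (a ≡ 0 × suc a ≡ M)
  ¬corner (refl , refl) = contradiction 2≤M λ { (s≤s ()) }
... | inj₁ 1+a<b with (a ℕ.≟ 0) ×-dec (b ℕ.≟ M)
...   | yes (refl , refl) = mk⇔ (λ _ → inj₂ (refl , refl)) λ _ →
  <⇒≢ a<b , trans (projℕ-wordW-distant 1+a<b ≤-refl) (sym (projℕ-wordV-corner a<b))
...   | no ¬corner = mk⇔
  (λ (a≢b , eq) → contradiction
    (trans (sym (projℕ-wordW-distant 1+a<b b≤M)) (trans eq (projℕ-wordV-alternating a<b b≤M ¬corner)))
    (grouped≢alternating a≢b))
  Sum.[ (λ b≡1+a → contradiction 1+a<b (ℕ.<-irrefl (sym b≡1+a))) , (λ corner → contradiction corner ¬corner) ]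

module _ {n : ℕ} where

  opaque
    unfolding projℕ occ

    toℕ-proj : ∀ (a b : Fin n) ws → map toℕ (proj a b ws) ≡ projℕ (toℕ a) (toℕ b) (map toℕ ws)
    toℕ-proj a b ws = sym (trans (filter-map (pair? (toℕ a) (toℕ b)) toℕ ws)
      (cong (map toℕ) (filter-≐ _ (λ x → (x Fin.≟ a) ⊎-dec (x Fin.≟ b))
        (Sum.map Fin.toℕ-injective Fin.toℕ-injective , Sum.map (cong toℕ) (cong toℕ)) ws)))

    count≡length-occ : ∀ (a : Fin n) ws → count a ws ≡ length (occ (toℕ a) (map toℕ ws))
    count≡length-occ a ws = sym (begin
      length (filter (ℕ._≟ toℕ a) (map toℕ ws))
        ≡⟨ cong length (filter-map (ℕ._≟ toℕ a) toℕ ws) ⟩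
      length (map toℕ (filter ((ℕ._≟ toℕ a) ∘ toℕ) ws))
        ≡⟨ length-map toℕ (filter ((ℕ._≟ toℕ a) ∘ toℕ) ws) ⟩
      length (filter ((ℕ._≟ toℕ a) ∘ toℕ) ws)
        ≡⟨ cong length (filter-≐ _ (Fin._≟ a) (Fin.toℕ-injective , cong toℕ) ws) ⟩
      count a ws
        ∎)

  GAdj⇔GAdjℕ : ∀ ws vs (a b : Fin n) →
               GAdj ws vs a b ⇔ GAdjℕ (map toℕ ws) (map toℕ vs) (toℕ a) (toℕ b)
  GAdj⇔GAdjℕ ws vs a b = mk⇔
    (λ (a≢b , eq) → a≢b ∘ Fin.toℕ-injective ,
       trans (sym (toℕ-proj a b ws)) (trans (cong (map toℕ) eq) (toℕ-proj a b vs)))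
    (λ (a≢b , eq) → a≢b ∘ cong toℕ ,
       map-injective Fin.toℕ-injective (trans (toℕ-proj a b ws) (trans eq (sym (toℕ-proj a b vs)))))

  count≡suc⇒∈ : ∀ {a : Fin n} ws {k} → count a ws ≡ suc k → a ∈ ws
  count≡suc⇒∈ {a} ws eq with filter (Fin._≟ a) ws in eqf
  ... | y ∷ _ = subst (_∈ ws) (proj₂ y∈) (proj₁ y∈)
    where y∈ = ∈-filter⁻ (Fin._≟ a) (subst (y ∈_) (sym eqf) (here refl))

  lift-< : ∀ {xs} → All (_< n) xs → Σ (Word n) (λ ws → map toℕ ws ≡ xs)
  lift-< []       = [] , refl
  lift-< (p ∷ ps) with ws , refl ← lift-< ps = fromℕ< p ∷ ws , cong (_∷ map toℕ ws) (Fin.toℕ-fromℕ< p)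

  InG₂-fromℕ : ∀ {Adj xs ys} →
    Σ (Word n) (λ ws → map toℕ ws ≡ xs) → Σ (Word n) (λ vs → map toℕ vs ≡ ys) →
    (∀ {x} → x < n → occ x xs ≡ x ∷ x ∷ []) → (∀ {x} → x < n → occ x ys ≡ x ∷ x ∷ []) →
    (∀ a b → Adj a b ⇔ GAdjℕ xs ys (toℕ a) (toℕ b)) → InG 2 n Adj
  InG₂-fromℕ (ws , refl) (vs , refl) occ-xs occ-ys adj =
    ws , vs , (λ a → count≡suc⇒∈ ws (twice-ws a)) , (λ a → count≡suc⇒∈ vs (twice-vs a)) ,
    (λ a _ → twice-ws a) , (λ a _ → twice-vs a) ,
    (λ a b → ⇔-sym (GAdj⇔GAdjℕ ws vs a b) ⇔-∘ adj a b)
    where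
    twice-ws : ∀ a → count a ws ≡ 2
    twice-ws a = trans (count≡length-occ a ws) (cong length (occ-xs (Fin.toℕ<n a)))
    twice-vs : ∀ a → count a vs ≡ 2
    twice-vs a = trans (count≡length-occ a vs) (cong length (occ-ys (Fin.toℕ<n a)))

CycleAdj-sym : ∀ {n} → Symmetric (CycleAdj n)
CycleAdj-sym (inj₁ e)               = inj₂ (inj₁ e)
CycleAdj-sym (inj₂ (inj₁ e))        = inj₁ e
CycleAdj-sym (inj₂ (inj₂ (inj₁ e))) = inj₂ (inj₂ (inj₂ e))
CycleAdj-sym (inj₂ (inj₂ (inj₂ e))) = inj₂ (inj₂ (inj₁ e))

CycleAdj-irrefl : ∀ {M} → 0 < M → Irreflexive _≡_ (CycleAdj (suc M))
CycleAdj-irrefl _   refl (inj₁ e)                         = ℕ.m+1+n≢m _ (sym e)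
CycleAdj-irrefl _   refl (inj₂ (inj₁ e))                  = ℕ.m+1+n≢m _ (sym e)
CycleAdj-irrefl 0<M refl (inj₂ (inj₂ (inj₁ (a≡0 , e))))   = <⇒≢ 0<M (trans (sym a≡0) (ℕ.suc-injective e))
CycleAdj-irrefl 0<M refl (inj₂ (inj₂ (inj₂ (a≡0 , e))))   = <⇒≢ 0<M (trans (sym a≡0) (ℕ.suc-injective e))

CycleAdj⇔CycleEdge : ∀ {M} {a b : Fin (suc M)} → a Fin.< b →
                     CycleAdj (suc M) a b ⇔ CycleEdge M (toℕ a) (toℕ b)
CycleAdj⇔CycleEdge {M} {a} {b} a<b = mk⇔ to from
  where
  to : CycleAdj (suc M) a b → CycleEdge M (toℕ a) (toℕ b)
  to (inj₁ b≡a+1)                          = inj₁ (trans b≡a+1 (+-comm (toℕ a) 1))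
  to (inj₂ (inj₁ a≡b+1))                   =
    contradiction (subst (toℕ b <_) (sym a≡b+1) (ℕ.m<m+n _ ℕ.0<1+n)) (ℕ.<-asym a<b)
  to (inj₂ (inj₂ (inj₁ (a≡0 , 1+b≡1+M)))) = inj₂ (a≡0 , ℕ.suc-injective 1+b≡1+M)
  to (inj₂ (inj₂ (inj₂ (b≡0 , _))))        = contradiction (subst (toℕ a <_) b≡0 a<b) ℕ.n≮0
  from : CycleEdge M (toℕ a) (toℕ b) → CycleAdj (suc M) a b
  from (inj₁ b≡1+a)       = inj₁ (trans b≡1+a (+-comm 1 (toℕ a)))
  from (inj₂ (a≡0 , b≡M)) = inj₂ (inj₂ (inj₁ (a≡0 , cong suc b≡M)))

cycle∈𝒢₂ : ∀ M → 2 ≤ M → InG 2 (suc M) (CycleAdj (suc M))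
cycle∈𝒢₂ M 2≤M = InG₂-fromℕ (lift-< (wordW-< M)) (lift-< (wordV-< M))
  (occ-wordW ∘ s≤s⁻¹) (occ-wordV 0<M ∘ s≤s⁻¹)
  (symmetric-⇔-from-< CycleAdj-sym GAdjℕ-sym
                      (CycleAdj-irrefl 0<M) (GAdjℕ-irrefl ∘ cong toℕ) adjacent)
  where
  0<M : 0 < M
  0<M = ℕ.<-trans ℕ.0<1+n 2≤M
  adjacent : ∀ {a b} → a Fin.< b → CycleAdj (suc M) a b ⇔ GAdjℕ (wordW M) (wordV M) (toℕ a) (toℕ b)
  adjacent {b = b} a<b =
    ⇔-sym (GAdjℕ-words⇔CycleEdge 2≤M a<b (s≤s⁻¹ (Fin.toℕ<n b))) ⇔-∘ CycleAdj⇔CycleEdge a<b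

theorem7 : (n : ℕ) → 5 ≤ n → InG 2 n (CycleAdj n)
theorem7 (suc M) (s≤s 4≤M) = cycle∈𝒢₂ M (≤-trans (s≤s (s≤s z≤n)) 4≤M)
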